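{- (1) $\mathbf{GR}^\circ \vdash \blacksquare\neg\bot$ and $\mathbf{GR}\vdash\neg\blacksquare\bot$. (2) For every $\mathcal{L}_2$-formula $B$, $\mathbf{GR}^-\nvdash\blacksquare B$. (3) For every $\mathcal{L}_2$-formula $B$, $\mathbf{GR}^\circ\nvdash\neg\blacksquare B$.
   Context: $\mathcal{L}_2$ is the bimodal propositional language with countably many propositional variables, $\bot$, connectives $\neg,\vee$ (others defined), and unary modal operators $\Box,\blacksquare$; $\Diamond$ abbreviates $\neg\Box\neg$. The logic $\mathbf{GR}^-$ has as axioms all propositional tautologies of $\mathcal{L}_2$ and all instances of $\Box(A\to B)\to(\Box A\to\Box B)$, $\Box(\Box A\to A)\to\Box A$, $\blacksquare A\to\Box A$, $\Box A\to\Box\blacksquare A$, $\Box A\to(\Box\bot\vee\blacksquare A)$, $\Diamond\blacksquare A\to\Diamond A$, and rules modus ponens and $\Box$-necessitation (from $A$ infer $\Box A$). $\mathbf{GR}$ is $\mathbf{GR}^-$ plus the rule: from $\Box A$ infer $A$. $\mathbf{GR}^\circ$ is $\mathbf{GR}^-$ plus the rule: from $A$ infer $\blacksquare A$. -}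

module Defs where

open import Data.Nat using (ℕ)
open import Data.Bool using (Bool; true; false; not; _∨_)
open import Relation.Binary.PropositionalEquality using (_≡_)

data Fm : Set where
  var  : ℕ → Fm
  ⊥'   : Fm
  ¬'_  : Fm → Fm
  _∨'_ : Fm → Fm → Fm
  □_   : Fm → Fm
  ■_   : Fm → Fm

infixr 4 _∨'_
infixr 3 _→'_
infix 6 ¬'_ □_ ■_ ◇_

_→'_ : Fm → Fm → Fm
A →' B = (¬' A) ∨' B

◇_ : Fm → Fm
◇ A = ¬' (□ (¬' A))

record Valuation : Set where
  field
    vVar : ℕ → Bool
    vBox : Fm → Bool
    vBBox : Fm → Bool

eval : Valuation → Fm → Bool
eval v (var n) = Valuation.vVar v n
eval v ⊥' = false
eval v (¬' A) = not (eval v A)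
eval v (A ∨' B) = eval v A ∨ eval v B
eval v (□ A) = Valuation.vBox v A
eval v (■ A) = Valuation.vBBox v A

Tautology : Fm → Set
Tautology A = (v : Valuation) → eval v A ≡ true

-- Derivability in GR⁻ and its extensions, parameterised by which extra
-- rules are available.
data Extra : Set where
  minus  : Extra
  refl□  : Extra
  nec■   : Extra

data _⊢_ (x : Extra) : Fm → Set where
  taut : ∀ {A} → Tautology A → x ⊢ A
  axK  : ∀ A B → x ⊢ (□ (A →' B) →' (□ A →' □ B))
  axL  : ∀ A → x ⊢ (□ (□ A →' A) →' □ A)
  ax1  : ∀ A → x ⊢ (■ A →' □ A)
  ax2  : ∀ A → x ⊢ (□ A →' □ (■ A))
  ax3  : ∀ A → x ⊢ (□ A →' (□ ⊥' ∨' ■ A))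
  ax4  : ∀ A → x ⊢ (◇ (■ A) →' ◇ A)
  mp   : ∀ {A B} → x ⊢ (A →' B) → x ⊢ A → x ⊢ B
  nec  : ∀ {A} → x ⊢ A → x ⊢ (□ A)
  ruleR : ∀ {A} → x ≡ refl□ → x ⊢ (□ A) → x ⊢ A
  ruleN : ∀ {A} → x ≡ nec■ → x ⊢ A → x ⊢ (■ A)

GR⁻ GR GR° : Extra
GR⁻ = minus
GR  = refl□
GR° = nec■

-- Positive parts: ¬⊥ is a tautology, so GR° derives ■¬⊥; in GR, contraposing
-- ◇■⊥ → ◇⊥ gives □¬⊥ → □¬■⊥, and reflection strips the □.
-- Negative parts: interpret □ as constantly true. Every GR⁻ axiom and the
-- □-necessitation rule are then valid whatever value ■ is given, so GR⁻ proves
-- only formulas true with ■ constantly false, and GR° (whose ■-necessitation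
-- needs ■ true) only formulas true with ■ constantly true.
module Submission where

open import Defs
open import Data.Bool using (Bool; true; false; not; _∨_)
open import Data.Bool.Properties using (∨-zeroʳ)
open import Data.Empty using (⊥-elim)
open import Data.Nat using (ℕ)
open import Data.Product using (_×_; _,_)
open import Relation.Binary.PropositionalEquality using (_≡_; refl)
open import Relation.Nullary using (¬_)

⊢¬⊥ : ∀ {x} → x ⊢ (¬' ⊥')
⊢¬⊥ = taut λ _ → refl

contraposition : ∀ {x A B} → x ⊢ (¬' A →' ¬' B) → x ⊢ (B →' A)
contraposition {A = A} {B} = mp (taut tautology)
  where
  tautology : Tautology ((¬' A →' ¬' B) →' (B →' A))
  tautology v with eval v A | eval v B
  ... | true  | true  = refl
  ... | true  | false = refl
  ... | false | true  = refl
  ... | false | false = refl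

GR°⊢■¬⊥ : GR° ⊢ (■ (¬' ⊥'))
GR°⊢■¬⊥ = ruleN refl ⊢¬⊥

GR⊢¬■⊥ : GR ⊢ (¬' (■ ⊥'))
GR⊢¬■⊥ = ruleR refl (mp (contraposition (ax4 ⊥')) (nec ⊢¬⊥))

boxTrue : (ℕ → Bool) → (Fm → Bool) → Valuation
boxTrue p b = record { vVar = p ; vBox = λ _ → true ; vBBox = b }

modusPonensᵇ : ∀ a b → (not a ∨ b) ≡ true → a ≡ true → b ≡ true
modusPonensᵇ true true  _ _ = refl
modusPonensᵇ false _    _ ()

boxTrue-sound : ∀ {x A} p b → ¬ (x ≡ GR) → (x ≡ GR° → ∀ B → b B ≡ true) →
                x ⊢ A → eval (boxTrue p b) A ≡ true
boxTrue-sound p b notGR ■-rule (taut t) = t (boxTrue p b)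
boxTrue-sound p b notGR ■-rule (axK _ _) = refl
boxTrue-sound p b notGR ■-rule (axL _)   = refl
boxTrue-sound p b notGR ■-rule (ax1 A)   = ∨-zeroʳ (not (b A))
boxTrue-sound p b notGR ■-rule (ax2 _)   = refl
boxTrue-sound p b notGR ■-rule (ax3 _)   = refl
boxTrue-sound p b notGR ■-rule (ax4 _)   = refl
boxTrue-sound p b notGR ■-rule (mp {A} {B} d e) =
  modusPonensᵇ (eval v A) (eval v B) (boxTrue-sound p b notGR ■-rule d)
                                      (boxTrue-sound p b notGR ■-rule e)
  where v = boxTrue p b
boxTrue-sound p b notGR ■-rule (nec _) = refl
boxTrue-sound p b notGR ■-rule (ruleR x≡GR _) = ⊥-elim (notGR x≡GR)
boxTrue-sound p b notGR ■-rule (ruleN {A} x≡GR° _) = ■-rule x≡GR° A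

GR⁻⊬■ : (B : Fm) → ¬ (GR⁻ ⊢ (■ B))
GR⁻⊬■ B d with boxTrue-sound (λ _ → true) (λ _ → false) (λ ()) (λ ()) d
... | ()

GR°⊬¬■ : (B : Fm) → ¬ (GR° ⊢ (¬' (■ B)))
GR°⊬¬■ B d with boxTrue-sound (λ _ → true) (λ _ → true) (λ ()) (λ _ _ → refl) d
... | ()

proposition3p5 : ((GR° ⊢ (■ (¬' ⊥'))) × (GR ⊢ (¬' (■ ⊥'))))
    × ((B : Fm) → ¬ (GR⁻ ⊢ (■ B)))
    × ((B : Fm) → ¬ (GR° ⊢ (¬' (■ B))))
proposition3p5 = (GR°⊢■¬⊥ , GR⊢¬■⊥) , GR⁻⊬■ , GR°⊬¬■
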